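{- Let $\mathbf A$ be a Girard semilattice satisfying $x\le((x\to y)\wedge 1)\to y$ for all $x,y$. Then the map $h:A\to D(\mathbf A)$, $h(a)=\mathbf a$, is an embedding of $\mathbf A$ into $\mathbf D(\mathbf A)$; that is, $h$ is injective and, for all $a,b\in A$, $h(a\to b)=h(a)\to h(b)$, $h(a\wedge b)=h(a)\cap h(b)$ and $h(1)=\mathbf 1$.
   Context: A (pointed) Girard semilattice is an algebra $\langle A,\to,\wedge,1\rangle$ such that $\langle A,\wedge,1\rangle$ is a meet-semilattice with a constant $1$ (with $\le$ the semilattice order) and for all $a,b,c\in A$: (L1) $1\to a=a$; (L2) $a\to a\ge 1$; (L3) $(a\to b)\wedge(a\to c)=a\to(b\wedge c)$; (L4) $a\to b\le (c\to a)\to(c\to b)$; (L5) $a\to(b\to c)\le b\to(a\to c)$; (L6) if $a\to b\ge 1$ and $b\to a\ge 1$ then $a=b$. Let $\Gamma_{\mathbf A}$ be the set of semilattice filters of $\mathbf A$ (nonempty up-closed subsets closed under $\wedge$). A set $X\subseteq\Gamma_{\mathbf A}$ is hereditary if $F\in X$ and $F\subseteq G\in\Gamma_{\mathbf A}$ imply $G\in X$; $D(\mathbf A)$ is the set of hereditary subsets of $\Gamma_{\mathbf A}$. For $a\in A$, $\mathbf a=\{F\in\Gamma_{\mathbf A}:a\in F\}$ (so $\mathbf 1=\{F:1\in F\}$). Define $R(F,G,H)$ iff for all $a,b\in A$, $a\in F$ and $a\to b\in G$ imply $b\in H$. For $X,Y\in D(\mathbf A)$ let $X\circ Y=\{H:\exists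 F\in Y,\ \exists G\in X,\ R(F,G,H)\}$ and $X\to Y=\{H: \forall F,G\ (R(F,H,G)\ \&\ F\in X\Rightarrow G\in Y)\}$; $\mathbf D(\mathbf A)=\langle D(\mathbf A),\to,\cup,\cap,\circ,\mathbf 1\rangle$. -}

module Defs where

open import Level using (Level; Lift; lift) renaming (zero to 0ℓ; suc to lsuc)
open import Data.Product using (Σ; ∃; _×_; _,_; proj₁)
open import Relation.Binary.PropositionalEquality using (_≡_)
open import Relation.Unary using (Pred; _⊆_; _≐_; _∩_)

record GirardSemilattice : Set₁ where
  infixr 5 _⇒_
  infixr 6 _∧_
  infix 4 _≤_
  field
    Carrier : Set
    _⇒_     : Carrier → Carrier → Carrier
    _∧_     : Carrier → Carrier → Carrier
    𝟙       : Carrier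
    ∧-assoc : ∀ a b c → (a ∧ b) ∧ c ≡ a ∧ (b ∧ c)
    ∧-comm  : ∀ a b → a ∧ b ≡ b ∧ a
    ∧-idem  : ∀ a → a ∧ a ≡ a

  _≤_ : Carrier → Carrier → Set
  a ≤ b = a ∧ b ≡ a

  field
    L1 : ∀ a → 𝟙 ⇒ a ≡ a
    L2 : ∀ a → 𝟙 ≤ a ⇒ a
    L3 : ∀ a b c → (a ⇒ b) ∧ (a ⇒ c) ≡ a ⇒ (b ∧ c)
    L4 : ∀ a b c → a ⇒ b ≤ (c ⇒ a) ⇒ (c ⇒ b)
    L5 : ∀ a b c → a ⇒ (b ⇒ c) ≤ b ⇒ (a ⇒ c)
    L6 : ∀ a b → 𝟙 ≤ a ⇒ b → 𝟙 ≤ b ⇒ a → a ≡ b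

module _ (𝐀 : GirardSemilattice) where
  open GirardSemilattice 𝐀

  record IsFilter (P : Pred Carrier 0ℓ) : Set where
    field
      nonempty : ∃ λ a → P a
      upClosed : ∀ {a b} → P a → a ≤ b → P b
      ∧-closed : ∀ {a b} → P a → P b → P (a ∧ b)

  record Filter : Set₁ where
    constructor mkFilter
    field
      pred     : Pred Carrier 0ℓ
      isFilter : IsFilter pred

  _∈F_ : Carrier → Filter → Set
  a ∈F F = Filter.pred F a

  _⊆F_ : Filter → Filter → Set
  F ⊆F G = Filter.pred F ⊆ Filter.pred G

  FSet : Set₂
  FSet = Pred Filter (lsuc 0ℓ)

  Hereditary : FSet → Set₁
  Hereditary X = ∀ {F G} → X F → F ⊆F G → X G

  D : Set₂
  D = Σ FSet Hereditary

  R : Filter → Filter → Filter → Set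
  R F G H = ∀ a b → a ∈F F → (a ⇒ b) ∈F G → b ∈F H

  ⟦_⟧ : Carrier → FSet
  ⟦ a ⟧ F = Lift (lsuc 0ℓ) (a ∈F F)

  _⇒D_ : FSet → FSet → FSet
  (X ⇒D Y) H = ∀ F G → R F H G → X F → Y G

  _∘D_ : FSet → FSet → FSet
  (X ∘D Y) H = ∃ λ F → ∃ λ G → Y F × X G × R F G H

  h : Carrier → FSet
  h a = ⟦ a ⟧

  ExtraAxiom : Set
  ExtraAxiom = ∀ x y → x ≤ ((x ⇒ y) ∧ 𝟙) ⇒ y

-- Filters separate points: a is recovered from its principal filter ↑ a,
-- which gives injectivity, and 𝐚 ∩ 𝐛 = 𝐚∧𝐛 because filters are closed under
-- ∧.  For h(a → b) ⊇ 𝐚 → 𝐛, given a filter H the set {y : a → y ∈ H} is a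
-- filter, and R(↑ a, H, {y : a → y ∈ H}) holds as soon as → is antitone in
-- its first argument.  Antitonicity is where the extra axiom is needed: it
-- makes 1 ≤ x → y imply x ≤ y, so the prefixing and exchange laws (L4), (L5)
-- can be turned into the inequality x → y ≤ a → y for a ≤ x.
{-# OPTIONS --safe #-}
module Submission where

open import Defs
open import Level using (lift; lower)
open import Function.Base using (flip; id)
open import Data.Product using (_×_; _,_; proj₁; proj₂)
open import Relation.Binary.PropositionalEquality
  using (_≡_; refl; sym; trans; cong; subst; isEquivalence)
open import Relation.Unary using (_≐_; _∩_)
open import Algebra.Lattice.Structures using (IsSemilattice)
import Relation.Binary.Construct.Flip.EqAndOrd as Flip
import Relation.Binary.Construct.NaturalOrder.Left as NaturalOrder
open import Relation.Binary.Bundles using (Poset)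

module GirardProperties (𝐀 : GirardSemilattice) where
  open GirardSemilattice 𝐀

  -- For the flipped equality x ≈ y := y ≡ x, the left natural order
  -- a ≈ a ∧ b of the standard library is literally a ≤ b.
  ∧-isSemilattice : IsSemilattice (flip _≡_) _∧_
  ∧-isSemilattice = record
    { isBand = record
      { isSemigroup = record
        { isMagma = record
          { isEquivalence = Flip.isEquivalence isEquivalence
          ; ∙-cong        = λ { refl refl → refl }
          }
        ; assoc = λ a b c → sym (∧-assoc a b c)
        }
      ; idem = λ a → sym (∧-idem a)
      }
    ; comm = λ a b → sym (∧-comm a b)
    }

  private
    module ∧-Order = NaturalOrder (flip _≡_) _∧_
    module ∧-Poset = Poset (∧-Order.poset ∧-isSemilattice)

  ≤-refl : ∀ {a} → a ≤ a
  ≤-refl = ∧-Poset.refl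

  ≤-trans : ∀ {a b c} → a ≤ b → b ≤ c → a ≤ c
  ≤-trans = ∧-Poset.trans

  ≤-antisym : ∀ {a b} → a ≤ b → b ≤ a → a ≡ b
  ≤-antisym a≤b b≤a = sym (∧-Poset.antisym a≤b b≤a)

  x∧y≤x : ∀ x y → x ∧ y ≤ x
  x∧y≤x = ∧-Order.x∙y≤x ∧-isSemilattice

  x∧y≤y : ∀ x y → x ∧ y ≤ y
  x∧y≤y = ∧-Order.x∙y≤y ∧-isSemilattice

  ∧-greatest : ∀ {x y z} → z ≤ x → z ≤ y → z ≤ x ∧ y
  ∧-greatest {z = z} = ∧-Order.∙-presʳ-≤ ∧-isSemilattice z

  ⇒-monoʳ-≤ : ∀ a {b c} → b ≤ c → a ⇒ b ≤ a ⇒ c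
  ⇒-monoʳ-≤ a {b} {c} b≤c = trans (L3 a b c) (cong (a ⇒_) b≤c)

  ≤⇒𝟙≤⇒ : ∀ {a b} → a ≤ b → 𝟙 ≤ a ⇒ b
  ≤⇒𝟙≤⇒ {a} a≤b = ≤-trans (L2 a) (⇒-monoʳ-≤ a a≤b)

  x≤a⇒[a⇒𝟙]⇒x : ∀ a x → x ≤ a ⇒ ((a ⇒ 𝟙) ⇒ x)
  x≤a⇒[a⇒𝟙]⇒x a x = ≤-trans prefixing (L5 (a ⇒ 𝟙) a x)
    where
    prefixing : x ≤ (a ⇒ 𝟙) ⇒ (a ⇒ x)
    prefixing = subst (_≤ (a ⇒ 𝟙) ⇒ (a ⇒ x)) (L1 x) (L4 𝟙 x a)

  ↑ : Carrier → Filter 𝐀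
  ↑ a = mkFilter (a ≤_) record
    { nonempty = a , ≤-refl
    ; upClosed = ≤-trans
    ; ∧-closed = ∧-greatest
    }

  residual : Carrier → Filter 𝐀 → Filter 𝐀
  residual a H = mkFilter (λ y → _∈F_ 𝐀 (a ⇒ y) H) record
    { nonempty = (a ⇒ 𝟙) ⇒ x , upClosed x∈H (x≤a⇒[a⇒𝟙]⇒x a x)
    ; upClosed = λ a⇒y∈H y≤z → upClosed a⇒y∈H (⇒-monoʳ-≤ a y≤z)
    ; ∧-closed = λ {y} {z} a⇒y∈H a⇒z∈H →
        subst (λ w → _∈F_ 𝐀 w H) (L3 a y z) (∧-closed a⇒y∈H a⇒z∈H)
    }
    where
    open IsFilter (Filter.isFilter H)
    x : Carrier
    x = proj₁ nonempty
    x∈H : _∈F_ 𝐀 x H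
    x∈H = proj₂ nonempty

  h-hereditary : ∀ a → Hereditary 𝐀 (h 𝐀 a)
  h-hereditary a (lift a∈F) F⊆G = lift (F⊆G a∈F)

  h-injective : ∀ a b → h 𝐀 a ≐ h 𝐀 b → a ≡ b
  h-injective a b (𝐚⊆𝐛 , 𝐛⊆𝐚) =
    ≤-antisym (lower (𝐚⊆𝐛 {↑ a} (lift ≤-refl))) (lower (𝐛⊆𝐚 {↑ b} (lift ≤-refl)))

  -- The filter is passed explicitly: it cannot be inferred through h 𝐀.
  h-∧ : ∀ a b → h 𝐀 (a ∧ b) ≐ (h 𝐀 a ∩ h 𝐀 b)
  h-∧ a b = (λ {F} → split F) , (λ {F} → join F)
    where
    split : ∀ F → h 𝐀 (a ∧ b) F → (h 𝐀 a ∩ h 𝐀 b) F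
    split F (lift a∧b∈F) =
      lift (upClosed a∧b∈F (x∧y≤x a b)) , lift (upClosed a∧b∈F (x∧y≤y a b))
      where open IsFilter (Filter.isFilter F)
    join : ∀ F → (h 𝐀 a ∩ h 𝐀 b) F → h 𝐀 (a ∧ b) F
    join F (lift a∈F , lift b∈F) = lift (∧-closed a∈F b∈F)
      where open IsFilter (Filter.isFilter F)

  h-⇒-⊆ : ∀ a b H → h 𝐀 (a ⇒ b) H → _⇒D_ 𝐀 (h 𝐀 a) (h 𝐀 b) H
  h-⇒-⊆ a b H (lift a⇒b∈H) F G RFHG (lift a∈F) = lift (RFHG a b a∈F a⇒b∈H)

module ExtraAxiomProperties (𝐀 : GirardSemilattice) (extra : ExtraAxiom 𝐀) where
  open GirardSemilattice 𝐀
  open GirardProperties 𝐀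

  𝟙≤⇒⇒≤ : ∀ {x y} → 𝟙 ≤ x ⇒ y → x ≤ y
  𝟙≤⇒⇒≤ {x} {y} 𝟙≤x⇒y = subst (x ≤_) collapse (extra x y)
    where
    collapse : ((x ⇒ y) ∧ 𝟙) ⇒ y ≡ y
    collapse = trans (cong (_⇒ y) (trans (∧-comm (x ⇒ y) 𝟙) 𝟙≤x⇒y)) (L1 y)

  ⇒-antimonoˡ-≤ : ∀ {a x} y → a ≤ x → x ⇒ y ≤ a ⇒ y
  ⇒-antimonoˡ-≤ {a} {x} y a≤x = 𝟙≤⇒⇒≤ (≤-trans (≤⇒𝟙≤⇒ a≤x) a⇒x≤[x⇒y]⇒a⇒y)
    where
    a⇒x≤[x⇒y]⇒a⇒y : a ⇒ x ≤ (x ⇒ y) ⇒ (a ⇒ y)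
    a⇒x≤[x⇒y]⇒a⇒y = 𝟙≤⇒⇒≤ (≤-trans (≤⇒𝟙≤⇒ (L4 x y a)) (L5 (x ⇒ y) (a ⇒ x) (a ⇒ y)))

  R-↑-residual : ∀ a H → R 𝐀 (↑ a) H (residual a H)
  R-↑-residual a H x y a≤x x⇒y∈H =
    IsFilter.upClosed (Filter.isFilter H) x⇒y∈H (⇒-antimonoˡ-≤ y a≤x)

  h-⇒-⊇ : ∀ a b H → _⇒D_ 𝐀 (h 𝐀 a) (h 𝐀 b) H → h 𝐀 (a ⇒ b) H
  h-⇒-⊇ a b H 𝐚⇒𝐛∋H =
    lift (lower (𝐚⇒𝐛∋H (↑ a) (residual a H) (R-↑-residual a H) (lift ≤-refl)))

  h-⇒ : ∀ a b → h 𝐀 (a ⇒ b) ≐ _⇒D_ 𝐀 (h 𝐀 a) (h 𝐀 b)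
  h-⇒ a b = (λ {H} → h-⇒-⊆ a b H) , (λ {H} → h-⇒-⊇ a b H)

mainTheorem7 : (𝐀 : GirardSemilattice) → ExtraAxiom 𝐀 →
    let open GirardSemilattice 𝐀 in
    (∀ a → Hereditary 𝐀 (h 𝐀 a))
    × (∀ a b → h 𝐀 a ≐ h 𝐀 b → a ≡ b)
    × (∀ a b → h 𝐀 (a ⇒ b) ≐ _⇒D_ 𝐀 (h 𝐀 a) (h 𝐀 b))
    × (∀ a b → h 𝐀 (a ∧ b) ≐ (h 𝐀 a ∩ h 𝐀 b))
    × (h 𝐀 𝟙 ≐ ⟦_⟧ 𝐀 𝟙)
mainTheorem7 𝐀 extra = h-hereditary , h-injective , h-⇒ , h-∧ , (id , id)
  where
  open GirardProperties 𝐀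
  open ExtraAxiomProperties 𝐀 extra
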